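{- Let $\mathcal{C} = \{c_{1},\ldots, c_{n}\}$ be a coin set with $c_1<\cdots<c_n$. If $c_{k} \mid c_{k+1}$ for all $1 \le k \le n-1$, then $\mathcal{C}$ is completely greedy and completely unique.
   Context: A coin set is a set of positive integers containing $1$; a sub-coin set is a subset containing $1$. A representation of a positive integer $m$ in $\mathcal{C}$ is $m=\sum_{c\in\mathcal{C}}\alpha_c c$ with $\alpha_c\in\mathbb{N}$; it is minimal if $\sum_c\alpha_c$ is minimized. The greedy representation repeatedly subtracts the largest coin not exceeding the remaining amount. A coin set is greedy if the greedy representation is minimal for every positive integer; it is unique if every positive integer has exactly one minimal representation. A coin set is completely greedy (resp. completely unique) if all of its sub-coin sets are greedy (resp. unique). -}

module Defs where

open import Data.Nat using (ℕ; zero; suc; _+_; _*_; _∸_; _≤_; _<_)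
open import Data.Nat.DivMod using (_/_)
open import Data.List using (List; []; _∷_; length; zipWith; reverse)
open import Data.Nat.ListAction using (sum)
open import Data.List.Relation.Unary.All using (All)
open import Data.List.Relation.Unary.Linked using (Linked)
open import Data.List.Membership.Propositional using (_∈_)
open import Data.Product using (Σ; _×_; ∃)
open import Relation.Binary.PropositionalEquality using (_≡_)

CoinSet : List ℕ → Set
CoinSet C = Linked _<_ C × All (λ c → 0 < c) C × 1 ∈ C

SubCoinSet : List ℕ → List ℕ → Set
SubCoinSet D C = Linked _<_ D × (∀ {d} → d ∈ D → d ∈ C) × 1 ∈ D

-- A representation in C is a list of multiplicities α, one per coin
-- (in the same order as C).
value : List ℕ → List ℕ → ℕ
value C α = sum (zipWith _*_ α C)

size : List ℕ → ℕ
size α = sum α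

IsRep : List ℕ → ℕ → List ℕ → Set
IsRep C m α = length α ≡ length C × value C α ≡ m

IsMinimalRep : List ℕ → ℕ → List ℕ → Set
IsMinimalRep C m α = IsRep C m α × (∀ β → IsRep C m β → size α ≤ size β)

-- Greedy algorithm on coins listed in decreasing order: use the current
-- (largest remaining) coin c as often as possible, i.e. r / c times,
-- then continue with the remainder.  (Coins are positive; the c = 0
-- clause is never used for coin sets.)
greedyDesc : List ℕ → ℕ → List ℕ
greedyDesc [] r = []
greedyDesc (zero ∷ cs) r = 0 ∷ greedyDesc cs r
greedyDesc (suc c ∷ cs) r = (r / suc c) ∷ greedyDesc cs (r ∸ (r / suc c) * suc c)

greedyRep : List ℕ → ℕ → List ℕ
greedyRep C m = reverse (greedyDesc (reverse C) m)

IsGreedy : List ℕ → Set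
IsGreedy C = ∀ m → 1 ≤ m → IsMinimalRep C m (greedyRep C m)

IsUnique : List ℕ → Set
IsUnique C = ∀ m → 1 ≤ m →
  Σ (List ℕ) (λ α → IsMinimalRep C m α × (∀ β → IsMinimalRep C m β → β ≡ α))

CompletelyGreedy : List ℕ → Set
CompletelyGreedy C = ∀ D → SubCoinSet D C → IsGreedy D

CompletelyUnique : List ℕ → Set
CompletelyUnique C = ∀ D → SubCoinSet D C → IsUnique D

-- Any sub-coin set of a divisibility chain is again a chain d₁ ∣ d₂ ∣ ⋯ with
-- d₁ = 1, so it suffices to show that such a chain is greedy and unique.
-- Let n be the largest coin and n′ the next one, n = k n′ with k ≥ 2.  A
-- representation using b coins n whose remaining coins have value v is
-- compared with the greedy one, which uses b + ⌊v/n⌋ coins n and then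
-- represents v mod n greedily.  By induction the rest costs at least as much
-- as the greedy representation of v in the smaller coins, and that one spends
-- k ⌊v/n⌋ coins n′ on the part ⌊v/n⌋ n; exchanging them for ⌊v/n⌋ coins n saves
-- (k − 1) ⌊v/n⌋ coins, which is positive unless ⌊v/n⌋ = 0.
module Submission where

open import Defs
open import Data.Nat using (ℕ; zero; suc; _+_; _*_; _≤_; _<_; s≤s)
open import Data.Nat.Properties
open import Data.Nat.DivMod
  using (_/_; _%_; m≡m%n+[m/n]*n; m%n≡m∸m/n*n; %-remove-+ˡ; +-distrib-/-∣ˡ; m*n/n≡m; n/1≡n)
open import Data.Nat.Divisibility
  using (_∣_; ∣-trans; divides-refl; quotient; m∣n⇒n≡quotient*m; quotient>1; 0∣⇒≡0)
open import Data.Nat.ListAction using (sum)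
open import Data.Nat.ListAction.Properties using (sum-↭)
open import Data.List using (List; []; _∷_; _++_; length; zipWith; reverse)
open import Data.List.Properties using (unfold-reverse; length-reverse; reverse-involutive)
open import Data.List.Relation.Binary.Permutation.Propositional.Properties using (↭-reverse)
open import Data.List.Relation.Unary.All as All using ([]; _∷_)
open import Data.List.Relation.Unary.Any using (here; there)
open import Data.List.Relation.Unary.Any.Properties as Any using ()
open import Data.List.Relation.Unary.AllPairs using (AllPairs; []; _∷_)
open import Data.List.Relation.Unary.AllPairs.Properties as AllPairs using ()
open import Data.List.Relation.Unary.Linked using (Linked; []; [-]; _∷_)
open import Data.List.Relation.Unary.Linked.Properties using (Linked⇒AllPairs; AllPairs⇒Linked)
open import Data.List.Membership.Propositional using (_∈_)
open import Data.Product using (_×_; _,_; proj₁; proj₂)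
open import Function using (flip)
open import Relation.Nullary using (contradiction)
open import Relation.Binary.PropositionalEquality

_∣<_ : ℕ → ℕ → Set
a ∣< b = a < b × a ∣ b

_≼_ : List ℕ → List ℕ → Set
α ≼ β = size α ≤ size β × (size β ≤ size α → β ≡ α)

≼-reflexive : ∀ {α β} → α ≡ β → α ≼ β
≼-reflexive refl = ≤-refl , λ _ → refl

m*n≤m⇒m≡0 : ∀ m {n} → 1 < n → m * n ≤ m → m ≡ 0
m*n≤m⇒m≡0 zero          _   _     = refl
m*n≤m⇒m≡0 m@(suc _) {n} 1<n m*n≤m = contradiction m*n≤m (<⇒≱ (m<m*n m n 1<n))

-- Trading t·k coins of the next coin for t coins of a coin k times as large.
≼-carry : ∀ {k} → 1 < k → ∀ b t {α β γ} → size γ ≡ t * k + size α →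
          γ ≼ β → (t ≡ 0 → γ ≡ α) → ((b + t) ∷ α) ≼ (b ∷ β)
≼-carry {k} 1<k@(s≤s (s≤s _)) b t {α} {β} {γ} γ-split (γ≤β , γ≥β⇒β≡γ) t≡0⇒γ≡α =
  subst (_≤ b + size β) (sym (+-assoc b t (size α))) (+-monoʳ-≤ b t+α≤β) , b∷β≡
  where
  t+α≤γ : t + size α ≤ size γ
  t+α≤γ = subst (t + size α ≤_) (sym γ-split) (+-monoˡ-≤ (size α) (m≤m*n t k))

  t+α≤β : t + size α ≤ size β
  t+α≤β = ≤-trans t+α≤γ γ≤β

  b∷β≡ : b + size β ≤ b + t + size α → b ∷ β ≡ (b + t) ∷ α
  b∷β≡ β≤ = cong₂ _∷_ (sym b+t≡b) (trans (γ≥β⇒β≡γ (≤-trans β≤t+α t+α≤γ)) (t≡0⇒γ≡α t≡0))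
    where
    β≤t+α : size β ≤ t + size α
    β≤t+α = +-cancelˡ-≤ b _ _ (subst (b + size β ≤_) (+-assoc b t (size α)) β≤)

    t≡0 : t ≡ 0
    t≡0 = m*n≤m⇒m≡0 t 1<k (+-cancelʳ-≤ (size α) _ _
            (subst (_≤ t + size α) γ-split (≤-trans γ≤β β≤t+α)))

    b+t≡b : b + t ≡ b
    b+t≡b = trans (cong (b +_) t≡0) (+-identityʳ b)

length-greedyDesc : ∀ E m → length (greedyDesc E m) ≡ length E
length-greedyDesc []          m = refl
length-greedyDesc (zero ∷ E)  m = cong suc (length-greedyDesc E m)
length-greedyDesc (suc _ ∷ E) m = cong suc (length-greedyDesc E _)

greedyDesc-suc : ∀ e E m →
  greedyDesc (suc e ∷ E) m ≡ m / suc e ∷ greedyDesc E (m % suc e)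
greedyDesc-suc e E m = cong (λ r → m / suc e ∷ greedyDesc E r) (sym (m%n≡m∸m/n*n m (suc e)))

greedyDesc-+* : ∀ e E b v →
  greedyDesc (suc e ∷ E) (b * suc e + v) ≡ (b + v / suc e) ∷ greedyDesc E (v % suc e)
greedyDesc-+* e E b v = trans (greedyDesc-suc e E (b * n + v)) (cong₂ _∷_ quotient-eq remainder-eq)
  where
  n = suc e

  quotient-eq : (b * n + v) / n ≡ b + v / n
  quotient-eq = trans (+-distrib-/-∣ˡ v (divides-refl b)) (cong (_+ v / n) (m*n/n≡m b n))

  remainder-eq : greedyDesc E ((b * n + v) % n) ≡ greedyDesc E (v % n)
  remainder-eq = cong (greedyDesc E) (%-remove-+ˡ v (divides-refl b))

size-greedyDesc-+* : ∀ e E b v →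
  size (greedyDesc (suc e ∷ E) (b * suc e + v)) ≡ b + size (greedyDesc (suc e ∷ E) v)
size-greedyDesc-+* e E b v = begin
  size (greedyDesc (suc e ∷ E) (b * suc e + v))           ≡⟨ cong size (greedyDesc-+* e E b v) ⟩
  b + v / suc e + size (greedyDesc E (v % suc e))          ≡⟨ +-assoc b _ _ ⟩
  b + (v / suc e + size (greedyDesc E (v % suc e)))        ≡⟨ cong (λ g → b + size g) (greedyDesc-suc e E v) ⟨
  b + size (greedyDesc (suc e ∷ E) v)                      ∎
  where open ≡-Reasoning

1∈-tail : ∀ {n c E} → c ∣< n → 1 ∈ n ∷ c ∷ E → 1 ∈ c ∷ E
1∈-tail {c = zero}  (_ , 0∣1)     (here refl) = contradiction (0∣⇒≡0 0∣1) λ ()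
1∈-tail {c = suc _} (s≤s () , _) (here refl)
1∈-tail             _            (there 1∈E) = 1∈E

value-greedyDesc : ∀ {E} → Linked (flip _∣<_) E → 1 ∈ E → ∀ m → value E (greedyDesc E m) ≡ m
value-greedyDesc [-] (here refl) m = trans (+-identityʳ _) (trans (*-identityʳ (m / 1)) (n/1≡n m))
value-greedyDesc {suc e ∷ c ∷ E} (c∣<n ∷ chain) one m = begin
  value (n ∷ c ∷ E) (greedyDesc (n ∷ c ∷ E) m)
    ≡⟨ cong (value (n ∷ c ∷ E)) (greedyDesc-suc e (c ∷ E) m) ⟩
  m / n * n + value (c ∷ E) (greedyDesc (c ∷ E) (m % n))
    ≡⟨ cong (m / n * n +_) (value-greedyDesc chain (1∈-tail c∣<n one) (m % n)) ⟩
  m / n * n + m % n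
    ≡⟨ +-comm (m / n * n) (m % n) ⟩
  m % n + m / n * n
    ≡⟨ m≡m%n+[m/n]*n m n ⟨
  m ∎
  where
  open ≡-Reasoning
  n = suc e
value-greedyDesc {zero ∷ _ ∷ _} ((() , _) ∷ _)

greedyDesc-≼ : ∀ {E} → Linked (flip _∣<_) E → 1 ∈ E →
  ∀ β → length β ≡ length E → greedyDesc E (value E β) ≼ β
greedyDesc-≼ [-] (here refl) (b ∷ []) _ =
  ≼-reflexive (cong (_∷ []) (trans (n/1≡n _) (trans (+-identityʳ _) (*-identityʳ b))))
greedyDesc-≼ {zero ∷ _ ∷ _} ((() , _) ∷ _)
greedyDesc-≼ {suc _ ∷ zero ∷ _} ((_ , 0∣n) ∷ _) = contradiction (0∣⇒≡0 0∣n) λ ()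
greedyDesc-≼ {suc e ∷ suc c ∷ E} (n′∣<n@(_ , n′∣n) ∷ chain) one (b ∷ β) len =
  subst (_≼ (b ∷ β)) (sym (greedyDesc-+* e (n′ ∷ E) b v))
    (≼-carry (quotient>1 n′∣n (proj₁ n′∣<n)) b t size-split
      (greedyDesc-≼ chain (1∈-tail n′∣<n one) β (suc-injective len))
      (λ t≡0 → cong (greedyDesc (n′ ∷ E)) (v≡r t≡0)))
  where
  n = suc e
  n′ = suc c
  v = value (n′ ∷ E) β
  t = v / n
  r = v % n
  k = quotient n′∣n

  v-split : v ≡ t * k * n′ + r
  v-split = begin
    v                  ≡⟨ m≡m%n+[m/n]*n v n ⟩
    r + t * n          ≡⟨ +-comm r (t * n) ⟩
    t * n + r          ≡⟨ cong (λ x → t * x + r) (m∣n⇒n≡quotient*m n′∣n) ⟩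
    t * (k * n′) + r   ≡⟨ cong (_+ r) (*-assoc t k n′) ⟨
    t * k * n′ + r     ∎
    where open ≡-Reasoning

  size-split : size (greedyDesc (n′ ∷ E) v) ≡ t * k + size (greedyDesc (n′ ∷ E) r)
  size-split = trans (cong (λ x → size (greedyDesc (n′ ∷ E) x)) v-split)
                     (size-greedyDesc-+* c E (t * k) r)

  v≡r : t ≡ 0 → v ≡ r
  v≡r t≡0 = trans (m≡m%n+[m/n]*n v n) (trans (cong (λ s → r + s * n) t≡0) (+-identityʳ r))

zipWith-++ : ∀ {A B C : Set} (f : A → B → C) {xs xs′ ys ys′} → length xs ≡ length ys →
  zipWith f (xs ++ xs′) (ys ++ ys′) ≡ zipWith f xs ys ++ zipWith f xs′ ys′
zipWith-++ f {[]}     {ys = []}                   _   = refl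
zipWith-++ f {x ∷ xs} {xs′} {y ∷ ys} {ys′} len =
  cong (f x y ∷_) (zipWith-++ f {xs} {xs′} {ys} {ys′} (suc-injective len))

zipWith-reverse : ∀ {A B C : Set} (f : A → B → C) {xs ys} → length xs ≡ length ys →
  zipWith f (reverse xs) (reverse ys) ≡ reverse (zipWith f xs ys)
zipWith-reverse f {[]}     {[]}     _   = refl
zipWith-reverse f {x ∷ xs} {y ∷ ys} len = begin
  zipWith f (reverse (x ∷ xs)) (reverse (y ∷ ys))
    ≡⟨ cong₂ (zipWith f) (unfold-reverse x xs) (unfold-reverse y ys) ⟩
  zipWith f (reverse xs ++ x ∷ []) (reverse ys ++ y ∷ [])
    ≡⟨ zipWith-++ f {xs′ = x ∷ []} {ys′ = y ∷ []} reverse-len ⟩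
  zipWith f (reverse xs) (reverse ys) ++ f x y ∷ []
    ≡⟨ cong (_++ f x y ∷ []) (zipWith-reverse f {xs} {ys} (suc-injective len)) ⟩
  reverse (zipWith f xs ys) ++ f x y ∷ []
    ≡⟨ unfold-reverse (f x y) (zipWith f xs ys) ⟨
  reverse (zipWith f (x ∷ xs) (y ∷ ys)) ∎
  where
  open ≡-Reasoning
  reverse-len : length (reverse xs) ≡ length (reverse ys)
  reverse-len = trans (length-reverse xs) (trans (suc-injective len) (sym (length-reverse ys)))

size-reverse : ∀ α → size (reverse α) ≡ size α
size-reverse α = sum-↭ (↭-reverse α)

value-reverse : ∀ C α → length α ≡ length C → value (reverse C) (reverse α) ≡ value C α
value-reverse C α len =
  trans (cong sum (zipWith-reverse _*_ {α} {C} len)) (sum-↭ (↭-reverse (zipWith _*_ α C)))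

≼-reverse : ∀ {α β} → α ≼ β → reverse α ≼ reverse β
≼-reverse {α} {β} (α≤β , β≤α⇒≡) =
  subst₂ _≤_ (sym (size-reverse α)) (sym (size-reverse β)) α≤β ,
  λ β≤α → cong reverse (β≤α⇒≡ (subst₂ _≤_ (size-reverse β) (size-reverse α) β≤α))

AllPairs-reverse⁺ : ∀ {R : ℕ → ℕ → Set} {xs} → AllPairs R xs → AllPairs (flip R) (reverse xs)
AllPairs-reverse⁺ []                    = []
AllPairs-reverse⁺ {R} {x ∷ xs} (Rx ∷ Rxs) =
  subst (AllPairs (flip R)) (sym (unfold-reverse x xs))
    (AllPairs.++⁺ (AllPairs-reverse⁺ Rxs) ([] ∷ [])
      (All.tabulate λ y∈ → All.lookup Rx (Any.reverse⁻ y∈) ∷ []))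

module DivisorChain {D : List ℕ} (D∣< : AllPairs _∣<_ D) (1∈D : 1 ∈ D) where

  private
    descending : Linked (flip _∣<_) (reverse D)
    descending = AllPairs⇒Linked (AllPairs-reverse⁺ D∣<)

    1∈reverse : 1 ∈ reverse D
    1∈reverse = Any.reverse⁺ 1∈D

  greedyRep-isRep : ∀ m → IsRep D m (greedyRep D m)
  greedyRep-isRep m = len , val
    where
    g = greedyDesc (reverse D) m

    len : length (reverse g) ≡ length D
    len = trans (length-reverse g) (trans (length-greedyDesc (reverse D) m) (length-reverse D))

    val : value D (reverse g) ≡ m
    val = begin
      value D (reverse g)                   ≡⟨ value-reverse D (reverse g) len ⟨
      value (reverse D) (reverse (reverse g)) ≡⟨ cong (value (reverse D)) (reverse-involutive g) ⟩
      value (reverse D) g                   ≡⟨ value-greedyDesc descending 1∈reverse m ⟩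
      m                                     ∎
      where open ≡-Reasoning

  greedyRep-≼ : ∀ {m β} → IsRep D m β → greedyRep D m ≼ β
  greedyRep-≼ {m} {β} (len , val) =
    subst₂ (λ x γ → reverse (greedyDesc (reverse D) x) ≼ γ)
      (trans (value-reverse D β len) val) (reverse-involutive β)
      (≼-reverse (greedyDesc-≼ descending 1∈reverse (reverse β) len′))
    where
    len′ : length (reverse β) ≡ length (reverse D)
    len′ = trans (length-reverse β) (trans len (sym (length-reverse D)))

  greedyRep-minimal : ∀ m → IsMinimalRep D m (greedyRep D m)
  greedyRep-minimal m = greedyRep-isRep m , λ β β-rep → proj₁ (greedyRep-≼ {β = β} β-rep)

  isGreedy : IsGreedy D
  isGreedy m _ = greedyRep-minimal m

  isUnique : IsUnique D
  isUnique m _ = greedyRep D m , greedyRep-minimal m ,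
    λ β (β-rep , β-min) →
      proj₂ (greedyRep-≼ {β = β} β-rep) (β-min (greedyRep D m) (greedyRep-isRep m))

∈-<⇒∣ : ∀ {C x y} → AllPairs _<_ C → AllPairs _∣_ C → x ∈ C → y ∈ C → x < y → x ∣ y
∈-<⇒∣ (_   ∷ _)   (_   ∷ _)   (here refl) (here refl) x<x = contradiction refl (<⇒≢ x<x)
∈-<⇒∣ (_   ∷ _)   (x∣C ∷ _)   (here refl) (there y∈C) _   = All.lookup x∣C y∈C
∈-<⇒∣ (y<C ∷ _)   (_   ∷ _)   (there x∈C) (here refl) x<y = contradiction (All.lookup y<C x∈C) (<-asym x<y)
∈-<⇒∣ (_   ∷ C<)  (_   ∷ C∣)  (there x∈C) (there y∈C) x<y = ∈-<⇒∣ C< C∣ x∈C y∈C x<y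

⊆-∣< : ∀ {C D} → AllPairs _<_ C → AllPairs _∣_ C →
  AllPairs _<_ D → (∀ {d} → d ∈ D → d ∈ C) → AllPairs _∣<_ D
⊆-∣< C< C∣ []          _   = []
⊆-∣< C< C∣ (x<D ∷ D<) D⊆C =
  All.tabulate (λ y∈D → let x<y = All.lookup x<D y∈D in
                 x<y , ∈-<⇒∣ C< C∣ (D⊆C (here refl)) (D⊆C (there y∈D)) x<y)
  ∷ ⊆-∣< C< C∣ D< (λ d∈D → D⊆C (there d∈D))

subCoinSet-∣< : ∀ {C D} → Linked _<_ C → Linked _∣_ C → SubCoinSet D C → AllPairs _∣<_ D
subCoinSet-∣< C< C∣ (D< , D⊆C , _) =
  ⊆-∣< (Linked⇒AllPairs <-trans C<) (Linked⇒AllPairs ∣-trans C∣) (Linked⇒AllPairs <-trans D<) D⊆C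

proposition6 : (C : List ℕ) → CoinSet C → Linked _∣_ C →
    CompletelyGreedy C × CompletelyUnique C
proposition6 C (C< , _ , _) C∣ =
  (λ D sub → DivisorChain.isGreedy (subCoinSet-∣< C< C∣ sub) (proj₂ (proj₂ sub))) ,
  (λ D sub → DivisorChain.isUnique (subCoinSet-∣< C< C∣ sub) (proj₂ (proj₂ sub)))
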